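{- Let $\mathcal{G}$ be an XPEG, as described in the context, all of whose coercion functions are total, and suppose $\mathcal{G}$ is well-formed. Then there exists a total (terminating) function $\mathrm{parse}$ such that for every type $\alpha$, every expression $e:\mathrm{PExp}(\alpha)$ with $e\in E(\mathcal{G})$ and every string $s$, $\mathrm{parse}(e,s)$ returns a result $r$ (either $\bot$ or $\mathrm{ok}(v,s')$ with $v\in\alpha$ and $s'$ a string) such that $(e,s)\Rightarrow_n r$ for some natural number $n$.
   Context: Fix a finite set $V_T$ of terminals (characters) and a finite set $V_N$ of non-terminals. Strings are finite lists of terminals; $[]$ is the empty list and $x::xs$ the list with head $x$ and tail $xs$. An XPEG is a tuple $(V_T, V_N, P_{type}, P_{exp}, v_{start})$ where $P_{type}: V_N \to \mathrm{Type}$, $P_{exp}$ assigns to each $A \in V_N$ a parsing expression of type $\mathrm{PExp}(P_{type}(A))$, and $v_{start}\in V_N$. Parsing expressions are typed by their semantic-value type: $\epsilon : \mathrm{PExp}(\mathrm{True})$ (where $\mathrm{True}$ has the single value $I$); any-character $[\cdot] : \mathrm{PExp}(\mathrm{char})$; a terminal $'a' : \mathrm{PExp}(\mathrm{char})$ for $a\in V_T$; a non-terminal $A : \mathrm{PExp}(P_{type}(A))$; if $e_1:\mathrm{PExp}(\alpha)$, $e_2:\mathrm{PExp}(\beta)$ then the sequence $e_1;e_2 : \mathrm{PExp}(\alpha\times\beta)$; if $e_1,e_2:\mathrm{PExp}(\alpha)$ then the prioritized choice $e_1/e_2:\mathrm{PExp}(\alpha)$; if $e:\mathrm{PExp}(\alpha)$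 then the repetition $e^* : \mathrm{PExp}(\mathrm{list}\,\alpha)$ and the not-predicate $!e : \mathrm{PExp}(\mathrm{True})$; if $e:\mathrm{PExp}(\alpha)$ and $f:\alpha\to\beta$ then the coercion $e[\to f]:\mathrm{PExp}(\beta)$. Semantics: the inductively defined relation $(e,s)\Rightarrow_m r$, where $r$ is either $\bot$ or $\mathrm{ok}(v,s')$, given by: $(\epsilon,s)\Rightarrow_1\mathrm{ok}(I,s)$; if $(P_{exp}(A),s)\Rightarrow_m r$ then $(A,s)\Rightarrow_{m+1} r$; $([\cdot],x::xs)\Rightarrow_1\mathrm{ok}(x,xs)$; $([\cdot],[])\Rightarrow_1\bot$; $('x',x::xs)\Rightarrow_1\mathrm{ok}(x,xs)$; $('x',[])\Rightarrow_1\bot$; if $x\neq y$ then $('y',x::xs)\Rightarrow_1\bot$; if $(e_1,s)\Rightarrow_m\bot$ and $(e_2,s)\Rightarrow_n r$ then $(e_1/e_2,s)\Rightarrow_{m+n+1} r$; if $(e_1,s)\Rightarrow_m\mathrm{ok}(v,s')$ then $(e_1/e_2,s)\Rightarrow_{m+1}\mathrm{ok}(v,s')$; if $(e_1,s)\Rightarrow_m\bot$ then $(e_1;e_2,s)\Rightarrow_{m+1}\bot$; if $(e_1,s)\Rightarrow_m\mathrm{ok}(v_1,s')$ and $(e_2,s')\Rightarrow_n\bot$ then $(e_1;e_2,s)\Rightarrow_{m+n+1}\bot$; if $(e_1,s)\Rightarrow_m\mathrm{ok}(v_1,s')$ and $(e_2,s')\Rightarrow_n\mathrm{ok}(v_2,s'')$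 then $(e_1;e_2,s)\Rightarrow_{m+n+1}\mathrm{ok}((v_1,v_2),s'')$; if $(e,s)\Rightarrow_m\bot$ then $(e^*,s)\Rightarrow_{m+1}\mathrm{ok}([],s)$; if $(e,s)\Rightarrow_m\mathrm{ok}(v,s')$ and $(e^*,s')\Rightarrow_n\mathrm{ok}(vs,s'')$ then $(e^*,s)\Rightarrow_{m+n+1}\mathrm{ok}(v::vs,s'')$; if $(e,s)\Rightarrow_m\bot$ then $(!e,s)\Rightarrow_{m+1}\mathrm{ok}(I,s)$; if $(e,s)\Rightarrow_m\mathrm{ok}(v,s')$ then $(!e,s)\Rightarrow_{m+1}\bot$; if $(e,s)\Rightarrow_m\mathrm{ok}(v,s')$ then $(e[\to f],s)\Rightarrow_{m+1}\mathrm{ok}(f(v),s')$; if $(e,s)\Rightarrow_m\bot$ then $(e[\to f],s)\Rightarrow_{m+1}\bot$. Well-formedness. The expression set $E(\mathcal{G})$ is the set of all (non-strict) sub-expressions of the expressions $P_{exp}(A)$, $A\in V_N$. Three property sets $P_0$ ("can succeed without consuming input"), $P_{>0}$ ("can succeed consuming input"), $P_\bot$ ("can fail") are the least subsets of $E(\mathcal{G})$ closed under the following rules (write $P_{\ge0}(e)$ for $P_0(e)\lor P_{>0}(e)$): $P_0(\epsilon)$; $P_{>0}([\cdot])$, $P_\bot([\cdot])$; $P_{>0}('a')$, $P_\bot('a')$; for $\star\in\{0,>0,\bot\}$, $P_\star(A)$ if $P_\star(P_{exp}(A))$; $P_\bot(e_1;e_2)$ if $P_\bot(e_1)$ or ($P_{\ge0}(e_1)$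 and $P_\bot(e_2)$); $P_{>0}(e_1;e_2)$ if ($P_{>0}(e_1)$ and $P_{\ge0}(e_2)$) or ($P_{\ge0}(e_1)$ and $P_{>0}(e_2)$); $P_0(e_1;e_2)$ if $P_0(e_1)$ and $P_0(e_2)$; $P_0(e_1/e_2)$ if $P_0(e_1)$ or ($P_\bot(e_1)$ and $P_0(e_2)$); $P_\bot(e_1/e_2)$ if $P_\bot(e_1)$ and $P_\bot(e_2)$; $P_{>0}(e_1/e_2)$ if $P_{>0}(e_1)$ or ($P_\bot(e_1)$ and $P_{>0}(e_2)$); $P_0(e^*)$ if $P_\bot(e)$; $P_{>0}(e^*)$ if $P_{>0}(e)$; $P_0(!e)$ if $P_\bot(e)$; $P_\bot(!e)$ if $P_{\ge0}(e)$; a coercion $e[\to f]$ has exactly the properties of $e$. The set $WF$ of well-formed expressions is the least subset of $E(\mathcal{G})$ closed under: $WF(A)$ if $WF(P_{exp}(A))$; $WF(\epsilon)$; $WF([\cdot])$; $WF('a')$; $WF(!e)$ if $WF(e)$; $WF(e_1;e_2)$ if $WF(e_1)$ and ($P_0(e_1)$ implies $WF(e_2)$); $WF(e_1/e_2)$ if $WF(e_1)$ and $WF(e_2)$; $WF(e^*)$ if $WF(e)$ and not $P_0(e)$; $WF(e[\to f])$ if $WF(e)$. The grammar $\mathcal{G}$ is well-formed if $WF=E(\mathcal{G})$. -}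

module Defs where

open import Data.Nat using (ℕ; suc; _+_)
open import Data.Fin using (Fin)
open import Data.List using (List; []; _∷_)
open import Data.Product using (_×_; _,_; Σ)
open import Data.Sum using (_⊎_)
open import Data.Unit using (⊤; tt)
open import Relation.Nullary using (¬_)
open import Relation.Binary.PropositionalEquality using (_≢_)

record Signature : Set₁ where
  field
    nT     : ℕ
    nN     : ℕ
    Ptype  : Fin nN → Set

  VT : Set
  VT = Fin nT

  VN : Set
  VN = Fin nN

  Str : Set
  Str = List VT

open Signature public

-- Typed parsing expressions PExp(α).  'True' is ⊤ (single value I = tt),
-- 'char' is the terminal type VT.

module _ (Sg : Signature) where

  infixr 5 _⨾_
  infixr 4 _／_

  data PExp : Set → Set₁ where
    ε      : PExp ⊤
    any    : PExp (VT Sg)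
    term   : VT Sg → PExp (VT Sg)
    nt     : (A : VN Sg) → PExp (Ptype Sg A)
    _⨾_    : ∀ {α β} → PExp α → PExp β → PExp (α × β)
    _／_   : ∀ {α} → PExp α → PExp α → PExp α
    _⋆     : ∀ {α} → PExp α → PExp (List α)
    !_     : ∀ {α} → PExp α → PExp ⊤
    _[→_]  : ∀ {α β} → PExp α → (α → β) → PExp β

  data Result (α : Set) : Set where
    fail : Result α
    ok   : α → Str Sg → Result α

-- An XPEG (V_T, V_N, P_type, P_exp, v_start).  Coercion functions are
-- Agda functions, hence total.

record XPEG : Set₁ where
  field
    sig    : Signature
    Pexp   : (A : VN sig) → PExp sig (Ptype sig A)
    vstart : VN sig

open XPEG public

module _ (G : XPEG) where

  private
    Sg = sig G

  data _,_⇒[_]_ : ∀ {α} → PExp Sg α → Str Sg → ℕ → Result Sg α → Set₁ where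
    ⇒-ε      : ∀ {s} → ε , s ⇒[ 1 ] ok tt s
    ⇒-nt     : ∀ {A s m r} → Pexp G A , s ⇒[ m ] r → nt A , s ⇒[ suc m ] r
    ⇒-any-ok : ∀ {x xs} → any , (x ∷ xs) ⇒[ 1 ] ok x xs
    ⇒-any-[] : any , [] ⇒[ 1 ] fail
    ⇒-t-ok   : ∀ {x xs} → term x , (x ∷ xs) ⇒[ 1 ] ok x xs
    ⇒-t-[]   : ∀ {x} → term x , [] ⇒[ 1 ] fail
    ⇒-t-fail : ∀ {x y xs} → x ≢ y → term y , (x ∷ xs) ⇒[ 1 ] fail
    ⇒-／-2   : ∀ {α} {e₁ e₂ : PExp Sg α} {s m n r} →
               e₁ , s ⇒[ m ] fail → e₂ , s ⇒[ n ] r →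
               (e₁ ／ e₂) , s ⇒[ m + n + 1 ] r
    ⇒-／-1   : ∀ {α} {e₁ e₂ : PExp Sg α} {s m v s'} →
               e₁ , s ⇒[ m ] ok v s' →
               (e₁ ／ e₂) , s ⇒[ m + 1 ] ok v s'
    ⇒-⨾-f1   : ∀ {α β} {e₁ : PExp Sg α} {e₂ : PExp Sg β} {s m} →
               e₁ , s ⇒[ m ] fail →
               (e₁ ⨾ e₂) , s ⇒[ m + 1 ] fail
    ⇒-⨾-f2   : ∀ {α β} {e₁ : PExp Sg α} {e₂ : PExp Sg β} {s m n v₁ s'} →
               e₁ , s ⇒[ m ] ok v₁ s' → e₂ , s' ⇒[ n ] fail →
               (e₁ ⨾ e₂) , s ⇒[ m + n + 1 ] fail
    ⇒-⨾-ok   : ∀ {α β} {e₁ : PExp Sg α} {e₂ : PExp Sg β} {s m n v₁ v₂ s' s''} →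
               e₁ , s ⇒[ m ] ok v₁ s' → e₂ , s' ⇒[ n ] ok v₂ s'' →
               (e₁ ⨾ e₂) , s ⇒[ m + n + 1 ] ok (v₁ , v₂) s''
    ⇒-⋆-nil  : ∀ {α} {e : PExp Sg α} {s m} →
               e , s ⇒[ m ] fail → (e ⋆) , s ⇒[ m + 1 ] ok [] s
    ⇒-⋆-cons : ∀ {α} {e : PExp Sg α} {s m n v vs s' s''} →
               e , s ⇒[ m ] ok v s' → (e ⋆) , s' ⇒[ n ] ok vs s'' →
               (e ⋆) , s ⇒[ m + n + 1 ] ok (v ∷ vs) s''
    ⇒-!-ok   : ∀ {α} {e : PExp Sg α} {s m} →
               e , s ⇒[ m ] fail → (! e) , s ⇒[ m + 1 ] ok tt s
    ⇒-!-fail : ∀ {α} {e : PExp Sg α} {s m v s'} →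
               e , s ⇒[ m ] ok v s' → (! e) , s ⇒[ m + 1 ] fail
    ⇒-→-ok   : ∀ {α β} {e : PExp Sg α} {f : α → β} {s m v s'} →
               e , s ⇒[ m ] ok v s' → (e [→ f ]) , s ⇒[ m + 1 ] ok (f v) s'
    ⇒-→-fail : ∀ {α β} {e : PExp Sg α} {f : α → β} {s m} →
               e , s ⇒[ m ] fail → (e [→ f ]) , s ⇒[ m + 1 ] fail

  data _≼_ : ∀ {α β} → PExp Sg α → PExp Sg β → Set₁ where
    ≼-refl : ∀ {α} {e : PExp Sg α} → e ≼ e
    ≼-⨾ˡ   : ∀ {γ α β} {e : PExp Sg γ} {e₁ : PExp Sg α} {e₂ : PExp Sg β} →
             e ≼ e₁ → e ≼ (e₁ ⨾ e₂)
    ≼-⨾ʳ   : ∀ {γ α β} {e : PExp Sg γ} {e₁ : PExp Sg α} {e₂ : PExp Sg β} →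
             e ≼ e₂ → e ≼ (e₁ ⨾ e₂)
    ≼-／ˡ  : ∀ {γ α} {e : PExp Sg γ} {e₁ e₂ : PExp Sg α} →
             e ≼ e₁ → e ≼ (e₁ ／ e₂)
    ≼-／ʳ  : ∀ {γ α} {e : PExp Sg γ} {e₁ e₂ : PExp Sg α} →
             e ≼ e₂ → e ≼ (e₁ ／ e₂)
    ≼-⋆    : ∀ {γ α} {e : PExp Sg γ} {e₁ : PExp Sg α} →
             e ≼ e₁ → e ≼ (e₁ ⋆)
    ≼-!    : ∀ {γ α} {e : PExp Sg γ} {e₁ : PExp Sg α} →
             e ≼ e₁ → e ≼ (! e₁)
    ≼-→    : ∀ {γ α β} {e : PExp Sg γ} {e₁ : PExp Sg α} {f : α → β} →
             e ≼ e₁ → e ≼ (e₁ [→ f ])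

  InE : ∀ {α} → PExp Sg α → Set₁
  InE e = Σ (VN Sg) λ A → e ≼ Pexp G A

  data Kind : Set where
    K0 K>0 K⊥ : Kind

  data P : ∀ {α} → Kind → PExp Sg α → Set₁ where
    p0-ε      : P K0 ε
    p>0-any   : P K>0 any
    p⊥-any    : P K⊥ any
    p>0-term  : ∀ {a} → P K>0 (term a)
    p⊥-term   : ∀ {a} → P K⊥ (term a)
    p-nt      : ∀ {k A} → P k (Pexp G A) → P k (nt A)
    p⊥-⨾1     : ∀ {α β} {e₁ : PExp Sg α} {e₂ : PExp Sg β} →
                P K⊥ e₁ → P K⊥ (e₁ ⨾ e₂)
    p⊥-⨾2     : ∀ {α β} {e₁ : PExp Sg α} {e₂ : PExp Sg β} →
                (P K0 e₁ ⊎ P K>0 e₁) → P K⊥ e₂ → P K⊥ (e₁ ⨾ e₂)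
    p>0-⨾1    : ∀ {α β} {e₁ : PExp Sg α} {e₂ : PExp Sg β} →
                P K>0 e₁ → (P K0 e₂ ⊎ P K>0 e₂) → P K>0 (e₁ ⨾ e₂)
    p>0-⨾2    : ∀ {α β} {e₁ : PExp Sg α} {e₂ : PExp Sg β} →
                (P K0 e₁ ⊎ P K>0 e₁) → P K>0 e₂ → P K>0 (e₁ ⨾ e₂)
    p0-⨾      : ∀ {α β} {e₁ : PExp Sg α} {e₂ : PExp Sg β} →
                P K0 e₁ → P K0 e₂ → P K0 (e₁ ⨾ e₂)
    p0-／1    : ∀ {α} {e₁ e₂ : PExp Sg α} → P K0 e₁ → P K0 (e₁ ／ e₂)
    p0-／2    : ∀ {α} {e₁ e₂ : PExp Sg α} →
                P K⊥ e₁ → P K0 e₂ → P K0 (e₁ ／ e₂)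
    p⊥-／     : ∀ {α} {e₁ e₂ : PExp Sg α} →
                P K⊥ e₁ → P K⊥ e₂ → P K⊥ (e₁ ／ e₂)
    p>0-／1   : ∀ {α} {e₁ e₂ : PExp Sg α} → P K>0 e₁ → P K>0 (e₁ ／ e₂)
    p>0-／2   : ∀ {α} {e₁ e₂ : PExp Sg α} →
                P K⊥ e₁ → P K>0 e₂ → P K>0 (e₁ ／ e₂)
    p0-⋆      : ∀ {α} {e : PExp Sg α} → P K⊥ e → P K0 (e ⋆)
    p>0-⋆     : ∀ {α} {e : PExp Sg α} → P K>0 e → P K>0 (e ⋆)
    p0-!      : ∀ {α} {e : PExp Sg α} → P K⊥ e → P K0 (! e)
    p⊥-!      : ∀ {α} {e : PExp Sg α} → (P K0 e ⊎ P K>0 e) → P K⊥ (! e)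
    p-→       : ∀ {k α β} {e : PExp Sg α} {f : α → β} →
                P k e → P k (e [→ f ])

  data WF : ∀ {α} → PExp Sg α → Set₁ where
    wf-nt   : ∀ {A} → WF (Pexp G A) → WF (nt A)
    wf-ε    : WF ε
    wf-any  : WF any
    wf-term : ∀ {a} → WF (term a)
    wf-!    : ∀ {α} {e : PExp Sg α} → WF e → WF (! e)
    wf-⨾    : ∀ {α β} {e₁ : PExp Sg α} {e₂ : PExp Sg β} →
              WF e₁ → (P K0 e₁ → WF e₂) → WF (e₁ ⨾ e₂)
    wf-／   : ∀ {α} {e₁ e₂ : PExp Sg α} → WF e₁ → WF e₂ → WF (e₁ ／ e₂)
    wf-⋆    : ∀ {α} {e : PExp Sg α} → WF e → ¬ P K0 e → WF (e ⋆)
    wf-→    : ∀ {α β} {e : PExp Sg α} {f : α → β} → WF e → WF (e [→ f ])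

  -- The grammar is well-formed: WF = E(G), i.e. every e ∈ E(G) is in WF.
  WellFormed : Set₁
  WellFormed = ∀ {α} (e : PExp Sg α) → InE e → WF e

module Submission where

-- A parse of e on s is computed by well-founded induction on the length of s and, for
-- a fixed s, by structural induction on the derivation of WF e.  The only recursive
-- calls that are not structural are to the second component of a sequence and to the
-- tail of a repetition.  They are justified by soundness of the property sets: if e
-- succeeds on s leaving s', then either s' = s and P₀ e holds, or s' is strictly
-- shorter than s.  In the first case WF (e₁ ; e₂) yields WF e₂, and for e* the first
-- case is excluded by ¬ P₀ e; in the second case the outer induction applies.

open import Defs
open import Level using (0ℓ) renaming (suc to lsuc)
open import Data.Product using (Σ; ∃; _,_; proj₁; proj₂)
open import Data.Sum using (_⊎_; inj₁; inj₂)
open import Data.Nat using (_<_)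
open import Data.Nat.Properties using (<-trans; n<1+n)
open import Data.Nat.Induction using (<-wellFounded)
open import Data.List using ([]; _∷_; length)
open import Data.Fin using (_≟_)
open import Data.Empty using (⊥-elim)
open import Induction.WellFounded using (module All)
open import Relation.Binary.Construct.On as On using ()
open import Relation.Nullary using (yes; no)
open import Relation.Binary.PropositionalEquality using (refl)

module _ (G : XPEG) where

  private
    Sg = sig G

  ≼-trans : ∀ {α β γ} {e : PExp Sg α} {e₁ : PExp Sg β} {e₂ : PExp Sg γ} →
            _≼_ G e e₁ → _≼_ G e₁ e₂ → _≼_ G e e₂
  ≼-trans p ≼-refl   = p
  ≼-trans p (≼-⨾ˡ q) = ≼-⨾ˡ (≼-trans p q)
  ≼-trans p (≼-⨾ʳ q) = ≼-⨾ʳ (≼-trans p q)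
  ≼-trans p (≼-／ˡ q) = ≼-／ˡ (≼-trans p q)
  ≼-trans p (≼-／ʳ q) = ≼-／ʳ (≼-trans p q)
  ≼-trans p (≼-⋆ q)  = ≼-⋆ (≼-trans p q)
  ≼-trans p (≼-! q)  = ≼-! (≼-trans p q)
  ≼-trans p (≼-→ q)  = ≼-→ (≼-trans p q)

  InE-≼ : ∀ {α β} {e : PExp Sg α} {e₁ : PExp Sg β} → _≼_ G e e₁ → InE G e₁ → InE G e
  InE-≼ p (A , q) = A , ≼-trans p q

  P≥0 : ∀ {α} → PExp Sg α → Set₁
  P≥0 e = P G K0 e ⊎ P G K>0 e

  data Exhibits {α} (e : PExp Sg α) (s : Str Sg) : Result Sg α → Set₁ where
    failing    : P G K⊥ e → Exhibits e s fail
    stationary : ∀ {v} → P G K0 e → Exhibits e s (ok v s)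
    consuming  : ∀ {v s'} → length s' < length s → P G K>0 e → Exhibits e s (ok v s')

  exhibits-ok-map : ∀ {α β} {e : PExp Sg α} {e' : PExp Sg β} {s v v' s'} →
                    (P G K0 e → P G K0 e') → (P G K>0 e → P G K>0 e') →
                    Exhibits e s (ok v s') → Exhibits e' s (ok v' s')
  exhibits-ok-map f g (stationary p)  = stationary (f p)
  exhibits-ok-map f g (consuming l p) = consuming l (g p)

  exhibits-ok⇒P≥0 : ∀ {α} {e : PExp Sg α} {s v s'} → Exhibits e s (ok v s') → P≥0 e
  exhibits-ok⇒P≥0 (stationary p)  = inj₁ p
  exhibits-ok⇒P≥0 (consuming _ p) = inj₂ p

  ⇒-exhibits : ∀ {α} {e : PExp Sg α} {s m r} → _,_⇒[_]_ G e s m r → Exhibits e s r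
  ⇒-exhibits-ok⇒P≥0 : ∀ {α} {e : PExp Sg α} {s m v s'} →
                       _,_⇒[_]_ G e s m (ok v s') → P≥0 e
  ⇒-exhibits-ok⇒P≥0 d = exhibits-ok⇒P≥0 (⇒-exhibits d)

  ⇒-exhibits ⇒-ε = stationary p0-ε
  ⇒-exhibits {r = fail}   (⇒-nt d) with ⇒-exhibits d
  ... | failing p = failing (p-nt p)
  ⇒-exhibits {r = ok _ _} (⇒-nt d) = exhibits-ok-map p-nt p-nt (⇒-exhibits d)
  ⇒-exhibits {s = _ ∷ xs} ⇒-any-ok = consuming (n<1+n (length xs)) p>0-any
  ⇒-exhibits ⇒-any-[] = failing p⊥-any
  ⇒-exhibits {s = _ ∷ xs} ⇒-t-ok = consuming (n<1+n (length xs)) p>0-term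
  ⇒-exhibits ⇒-t-[] = failing p⊥-term
  ⇒-exhibits (⇒-t-fail _) = failing p⊥-term
  ⇒-exhibits (⇒-／-2 d₁ d₂) with ⇒-exhibits d₁ | ⇒-exhibits d₂
  ... | failing p | failing q     = failing (p⊥-／ p q)
  ... | failing p | stationary q  = stationary (p0-／2 p q)
  ... | failing p | consuming l q = consuming l (p>0-／2 p q)
  ⇒-exhibits (⇒-／-1 d) = exhibits-ok-map p0-／1 p>0-／1 (⇒-exhibits d)
  ⇒-exhibits (⇒-⨾-f1 d) with ⇒-exhibits d
  ... | failing p = failing (p⊥-⨾1 p)
  ⇒-exhibits (⇒-⨾-f2 d₁ d₂) with ⇒-exhibits d₂
  ... | failing q = failing (p⊥-⨾2 (⇒-exhibits-ok⇒P≥0 d₁) q)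
  ⇒-exhibits (⇒-⨾-ok d₁ d₂) with ⇒-exhibits d₁ | ⇒-exhibits d₂
  ... | stationary p  | stationary q   = stationary (p0-⨾ p q)
  ... | stationary p  | consuming l q  = consuming l (p>0-⨾2 (inj₁ p) q)
  ... | consuming l p | stationary q   = consuming l (p>0-⨾1 p (inj₁ q))
  ... | consuming l p | consuming l' q = consuming (<-trans l' l) (p>0-⨾1 p (inj₂ q))
  ⇒-exhibits (⇒-⋆-nil d) with ⇒-exhibits d
  ... | failing p = stationary (p0-⋆ p)
  ⇒-exhibits (⇒-⋆-cons d₁ d₂) with ⇒-exhibits d₁ | ⇒-exhibits d₂
  ... | stationary _  | stationary q   = stationary q
  ... | stationary _  | consuming l q  = consuming l q
  ... | consuming l p | stationary _   = consuming l (p>0-⋆ p)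
  ... | consuming l p | consuming l' _ = consuming (<-trans l' l) (p>0-⋆ p)
  ⇒-exhibits (⇒-!-ok d) with ⇒-exhibits d
  ... | failing p = stationary (p0-! p)
  ⇒-exhibits (⇒-!-fail d) = failing (p⊥-! (⇒-exhibits-ok⇒P≥0 d))
  ⇒-exhibits (⇒-→-fail d) with ⇒-exhibits d
  ... | failing p = failing (p-→ p)
  ⇒-exhibits (⇒-→-ok d) = exhibits-ok-map p-→ p-→ (⇒-exhibits d)

  Parse : ∀ {α} → PExp Sg α → Str Sg → Set₁
  Parse e s = Σ (Result Sg _) λ r → ∃ λ m → _,_⇒[_]_ G e s m r

  ParsesShorter : Str Sg → Set₁
  ParsesShorter s = ∀ {β} (e : PExp Sg β) → InE G e →
                    ∀ {s'} → length s' < length s → Parse e s'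

  parse-⨾ : ∀ {α β} {e₁ : PExp Sg α} {e₂ : PExp Sg β} {s m v s'} →
            _,_⇒[_]_ G e₁ s m (ok v s') → Parse e₂ s' → Parse (e₁ ⨾ e₂) s
  parse-⨾ d₁ (fail , _ , d₂)   = _ , _ , ⇒-⨾-f2 d₁ d₂
  parse-⨾ d₁ (ok _ _ , _ , d₂) = _ , _ , ⇒-⨾-ok d₁ d₂

  parse-⋆ : ∀ {α} {e : PExp Sg α} {s m v s'} →
            _,_⇒[_]_ G e s m (ok v s') → Parse (e ⋆) s' → Parse (e ⋆) s
  parse-⋆ d (ok _ _ , _ , d⋆) = _ , _ , ⇒-⋆-cons d d⋆
  parse-⋆ d (fail , _ , ())

  parseWF : ∀ {α} {e : PExp Sg α} → InE G e → WF G e →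
            ∀ s → ParsesShorter s → Parse e s
  parseWF h (wf-nt w) s ih with parseWF (_ , ≼-refl) w s ih
  ... | _ , _ , d = _ , _ , ⇒-nt d
  parseWF h wf-ε s ih = _ , _ , ⇒-ε
  parseWF h wf-any []      ih = _ , _ , ⇒-any-[]
  parseWF h wf-any (_ ∷ _) ih = _ , _ , ⇒-any-ok
  parseWF h wf-term [] ih = _ , _ , ⇒-t-[]
  parseWF h (wf-term {a}) (x ∷ _) ih with x ≟ a
  ... | yes refl = _ , _ , ⇒-t-ok
  ... | no x≢a   = _ , _ , ⇒-t-fail x≢a
  parseWF h (wf-! w) s ih with parseWF (InE-≼ (≼-! ≼-refl) h) w s ih
  ... | fail , _ , d   = _ , _ , ⇒-!-ok d
  ... | ok _ _ , _ , d = _ , _ , ⇒-!-fail d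
  parseWF h (wf-→ w) s ih with parseWF (InE-≼ (≼-→ ≼-refl) h) w s ih
  ... | fail , _ , d   = _ , _ , ⇒-→-fail d
  ... | ok _ _ , _ , d = _ , _ , ⇒-→-ok d
  parseWF h (wf-／ w₁ w₂) s ih with parseWF (InE-≼ (≼-／ˡ ≼-refl) h) w₁ s ih
  ... | ok _ _ , _ , d₁ = _ , _ , ⇒-／-1 d₁
  ... | fail , _ , d₁ with parseWF (InE-≼ (≼-／ʳ ≼-refl) h) w₂ s ih
  ...   | _ , _ , d₂ = _ , _ , ⇒-／-2 d₁ d₂
  parseWF {e = e₁ ⨾ e₂} h (wf-⨾ w₁ w₂) s ih
    with parseWF (InE-≼ (≼-⨾ˡ ≼-refl) h) w₁ s ih
  ... | fail , _ , d₁ = _ , _ , ⇒-⨾-f1 d₁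
  ... | ok _ _ , _ , d₁ with ⇒-exhibits d₁
  ...   | stationary p  = parse-⨾ d₁ (parseWF (InE-≼ (≼-⨾ʳ ≼-refl) h) (w₂ p) s ih)
  ...   | consuming l _ = parse-⨾ d₁ (ih e₂ (InE-≼ (≼-⨾ʳ ≼-refl) h) l)
  parseWF {e = e ⋆} h (wf-⋆ w ¬p0) s ih with parseWF (InE-≼ (≼-⋆ ≼-refl) h) w s ih
  ... | fail , _ , d = _ , _ , ⇒-⋆-nil d
  ... | ok _ _ , _ , d with ⇒-exhibits d
  ...   | stationary p  = ⊥-elim (¬p0 p)
  ...   | consuming l _ = parse-⋆ d (ih (e ⋆) h l)

  parseInE : WellFormed G → ∀ s {α} (e : PExp Sg α) → InE G e → Parse e s
  parseInE wfG = All.wfRec (On.wellFounded length <-wellFounded) (lsuc 0ℓ)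
    (λ s → ∀ {α} (e : PExp Sg α) → InE G e → Parse e s)
    (λ s ih e h → parseWF h (wfG e h) s (λ e' h' l → ih l e' h'))

mainTheorem4 : (G : XPEG) → WellFormed G →
    Σ ((α : Set) (e : PExp (sig G) α) → InE G e → Str (sig G) → Result (sig G) α)
      λ parse → (α : Set) (e : PExp (sig G) α) (h : InE G e) (s : Str (sig G)) →
        ∃ λ n → _,_⇒[_]_ G e s n (parse α e h s)
mainTheorem4 G wfG =
  (λ α e h s → proj₁ (parseInE G wfG s e h)) ,
  (λ α e h s → proj₂ (parseInE G wfG s e h))
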